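{- Let $G=(V,E)$ be a finite simple graph with variables $x_v$ ($v\in V$) and $y_e$ ($e\in E$), and let each edge carry its own label. Then the Heilmann–Lieb multivariate matching polynomial satisfies $$M_{col}(G,\bar x,\bar y)=\sum_{M\subseteq E,\ M\text{ a matching}}\ \prod_{e=\{u,v\}\in M}y_e x_u x_v=\xi_{lab}(G,1,0,1,\bar t),$$ where $t_e=y_e x_u x_v$ for every edge $e=\{u,v\}$.
   Context: For $S\subseteq E$, $V(S)$ is the set of vertices covered by $S$, $k(S)$ the number of connected components of $(V,S)$, and $k_{cov}(B)$ the number of connected components of $(V(B),B)$. With a weight $t_e$ for each edge, $\xi_{lab}(G,x,y,z,\bar t)=\sum_{(A,B)} x^{k(A\cup B)}\big(\prod_{e\in A\cup B} y\,t_{e}\big)\big(\tfrac{z}{xy}\big)^{k_{cov}(B)}$, summing over pairs $A,B\subseteq E$ with $V(A)\cap V(B)=\emptyset$; this is a polynomial in $x,y,z,\bar t$ (powers of $x,y$ in denominators never exceed those in numerators), which is then evaluated, with $0^0=1$. -}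

module Defs where

open import Level using (Level)
open import Data.Bool using (Bool; true; false; _∧_; _∨_; not; if_then_else_)
open import Data.Nat using (ℕ; zero; suc; _∸_)
open import Data.Fin using (Fin; _≟_; _<?_)
open import Data.Fin.Subset using (Subset; _∪_; inside; outside)
open import Data.Vec using (_∷_; []; lookup)
open import Data.List using (List; []; _∷_; map; _++_; foldr; allFin; filter; length)
open import Data.Bool.ListAction using (any; all)
open import Data.Product using (_×_; _,_; proj₁; proj₂)
open import Data.Sum using (_⊎_)
open import Relation.Nullary.Decidable using (⌊_⌋)
open import Relation.Binary.PropositionalEquality using (_≡_; _≢_)
open import Algebra.Bundles using (CommutativeRing)

-- Finite simple graphs G = (V,E): V = Fin n, E = Fin m (each edge is its
-- own label).  Every edge has two distinct endpoints, and no two distinct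
-- edges join the same pair of vertices.

record SimpleGraph : Set where
  field
    n    : ℕ
    m    : ℕ
    ends : Fin m → Fin n × Fin n
    loopless : ∀ e → proj₁ (ends e) ≢ proj₂ (ends e)
    noMulti  : ∀ e e' →
      ((proj₁ (ends e) ≡ proj₁ (ends e') × proj₂ (ends e) ≡ proj₂ (ends e'))
       ⊎ (proj₁ (ends e) ≡ proj₂ (ends e') × proj₂ (ends e) ≡ proj₁ (ends e'))) →
      e ≡ e'

subsets : (k : ℕ) → List (Subset k)
subsets zero    = [] ∷ []
subsets (suc k) = map (outside ∷_) (subsets k) ++ map (inside ∷_) (subsets k)

module _ (G : SimpleGraph) where
  open SimpleGraph G

  mem : Fin m → Subset m → Bool
  mem e S = lookup S e

  incident : Fin n → Fin m → Bool
  incident v e = ⌊ v ≟ proj₁ (ends e) ⌋ ∨ ⌊ v ≟ proj₂ (ends e) ⌋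

  covered : Subset m → Fin n → Bool
  covered S v = any (λ e → mem e S ∧ incident v e) (allFin m)

  vdisjoint : Subset m → Subset m → Bool
  vdisjoint A B = all (λ v → not (covered A v ∧ covered B v)) (allFin n)

  adjacentEdges : Fin m → Fin m → Bool
  adjacentEdges e e' = any (λ v → incident v e ∧ incident v e') (allFin n)

  isMatching : Subset m → Bool
  isMatching M = all (λ e → all (λ e' →
      not (mem e M ∧ mem e' M ∧ not ⌊ e ≟ e' ⌋ ∧ adjacentEdges e e'))
      (allFin m)) (allFin m)

  card : Subset m → ℕ
  card S = length (filter (λ e → Data.Bool._≟_ (mem e S) true) (allFin m))

  reach : Subset m → ℕ → Fin n → Fin n → Bool
  reach S zero    u v = ⌊ u ≟ v ⌋
  reach S (suc j) u v = reach S j u v ∨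
    any (λ e → mem e S ∧
      ((reach S j u (proj₁ (ends e)) ∧ ⌊ v ≟ proj₂ (ends e) ⌋) ∨
       (reach S j u (proj₂ (ends e)) ∧ ⌊ v ≟ proj₁ (ends e) ⌋))) (allFin m)

  -- u and v lie in the same connected component of (V,S)
  -- (walks of length ≤ n suffice)
  connected : Subset m → Fin n → Fin n → Bool
  connected S = reach S n

  leastInComponent : Subset m → Fin n → Bool
  leastInComponent S v = not (any (λ w → ⌊ w <? v ⌋ ∧ connected S w v) (allFin n))

  kcomp : Subset m → ℕ
  kcomp S = length (filter (λ v → Data.Bool._≟_ (leastInComponent S v) true) (allFin n))

  -- k_cov(B): number of connected components of (V(B),B)
  -- (components of (V,B) all of whose vertices are covered by B; counted
  --  via their least vertex, which must then be covered)
  kcov : Subset m → ℕ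
  kcov B = length (filter (λ v → Data.Bool._≟_ (covered B v ∧ leastInComponent B v) true) (allFin n))

  module _ {c ℓ : Level} (R : CommutativeRing c ℓ) where
    open CommutativeRing R

    pow : Carrier → ℕ → Carrier
    pow a zero    = 1#
    pow a (suc k) = a * pow a k

    Σ-list : {A : Set} → List A → (A → Carrier) → Carrier
    Σ-list xs f = foldr (λ a r → f a + r) 0# xs

    prodOver : Subset m → (Fin m → Carrier) → Carrier
    prodOver S f = foldr (λ e r → (if mem e S then f e else 1#) * r) 1# (allFin m)

    Mcol : (Fin n → Carrier) → (Fin m → Carrier) → Carrier
    Mcol x y = Σ-list (subsets m) λ M →
      if isMatching M
      then prodOver M (λ e → y e * x (proj₁ (ends e)) * x (proj₂ (ends e)))
      else 0#

    -- ξ_lab(G,x,y,z,t̄) as a polynomial, then evaluated (0^0 = 1).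
    -- The summand for (A,B) is
    --   x^{k(A∪B)} (∏_{e∈A∪B} y t_e) (z/(xy))^{k_cov(B)}
    --   = x^{k(A∪B) - k_cov(B)} y^{|A∪B| - k_cov(B)} z^{k_cov(B)} ∏_{e∈A∪B} t_e ,
    -- where both exponent differences are ≥ 0 (so ∸ is true subtraction).
    ξlab : Carrier → Carrier → Carrier → (Fin m → Carrier) → Carrier
    ξlab x y z t = Σ-list (subsets m) λ A → Σ-list (subsets m) λ B →
      if vdisjoint A B
      then pow x (kcomp (A ∪ B) ∸ kcov B) * pow y (card (A ∪ B) ∸ kcov B)
           * pow z (kcov B) * prodOver (A ∪ B) t
      else 0#

module Submission where

-- At x = 1, y = 0, z = 1 the summand of ξ_lab for a vertex-disjoint pair (A,B)
-- is 0^(|A ∪ B| ∸ k_cov(B)) · ∏_{e ∈ A ∪ B} t_e.  It survives exactly when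
-- A = ∅ and B is a matching, and then it is the summand of M_col for B.  This
-- rests on two counting facts:
--   (i)  k_cov(B) ≤ |B|, with equality iff B is a matching;
--   (ii) |B| < |A ∪ B| whenever A has an edge and V(A) ∩ V(B) = ∅.
-- Fact (i) is proved vertex by vertex.  Charge every edge to its smaller
-- endpoint, so |B| = Σ_v charge_B(v), while k_cov(B) = Σ_v root_B(v) with
-- root_B(v) = 1 iff v is the least vertex of a component of (V(B),B).  Then
-- root_B ≤ charge_B everywhere; equality holds everywhere when B is a matching
-- (its components are single edges), and is strict at some vertex otherwise.

open import Defs
open import Level using (Level)
open import Algebra.Bundles using (CommutativeRing)
open import Data.Bool using (Bool; true; false; T; _∧_; _∨_; not; if_then_else_)
import Data.Bool as Bool
open import Data.Bool.Properties using (T-∧; T-∨)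
open import Data.Bool.ListAction using (any; all)
open import Data.Nat using (ℕ; zero; suc; _∸_; _≤_; _<_; _≤′_; ≤′-refl; ≤′-step; z≤n; s≤s)
open import Data.Nat.Properties using
  ( +-0-commutativeMonoid; ≤-refl; ≤-trans; ≤-antisym; ≤-reflexive; ≤⇒≤′
  ; <-≤-trans; ≤-<-trans; +-mono-≤; +-mono-<-≤; +-mono-≤-<; m≤m+n; m≤n+m
  ; m∸n≡0⇒m≤n; m≤n⇒m∸n≡0; n≮n )
open import Algebra.Properties.CommutativeMonoid.Sum +-0-commutativeMonoid
  using (sum; sum-syntax; ∑-comm; sum-cong-≗; sum-replicate-zero)
open import Data.Fin using (Fin; zero; suc; _≟_; _<?_)
import Data.Fin as Fin
open import Data.Fin.Properties using (suc-injective; <-cmp; <-irrefl; <-asym; <⇒≢)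
open import Data.Fin.Subset using (Subset; _∪_; ⊥; inside; outside)
open import Data.Fin.Subset.Properties using (∪-identityˡ)
open import Data.Vec using (_∷_; lookup)
open import Data.Vec.Properties using (lookup-zipWith; lookup-replicate)
open import Data.List using (List; []; _∷_; _++_; map; length; filter; tabulate; allFin)
open import Data.List.Relation.Unary.Any.Properties using (any⁺; any⁻)
import Data.List.Relation.Unary.Any.Properties as Any
open import Data.List.Relation.Unary.All.Properties using (all⁺; all⁻; ¬All⇒Any¬)
import Data.List.Relation.Unary.All.Properties as All
open import Data.Product using (∃-syntax; _×_; _,_; proj₁; proj₂)
open import Data.Sum using (_⊎_; inj₁; inj₂)
import Data.Sum as Sum
open import Function using (_∘_; id; Equivalence)
open import Relation.Nullary using (¬_; Dec; contradiction; yes; no)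
open import Relation.Nullary.Decidable using (⌊_⌋; toWitness; fromWitness; T?)
open import Relation.Binary using (tri<; tri≈; tri>)
open import Relation.Binary.PropositionalEquality
  using (_≡_; _≢_; refl; sym; trans; cong; cong₂; subst; subst₂; module ≡-Reasoning)
import Relation.Binary.Reasoning.Setoid as SetoidReasoning

∧-intro : ∀ {a b} → T a → T b → T (a ∧ b)
∧-intro p q = Equivalence.from T-∧ (p , q)

∧-split : ∀ a {b} → T (a ∧ b) → T a × T b
∧-split a = Equivalence.to (T-∧ {a})

∨-introˡ : ∀ {a b} → T a → T (a ∨ b)
∨-introˡ p = Equivalence.from T-∨ (inj₁ p)

∨-introʳ : ∀ {a b} → T b → T (a ∨ b)
∨-introʳ {a} q = Equivalence.from (T-∨ {a}) (inj₂ q)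

∨-elim : ∀ {a b} → T (a ∨ b) → T a ⊎ T b
∨-elim {a} = Equivalence.to (T-∨ {a})

not-intro : ∀ {a} → ¬ T a → T (not a)
not-intro {false} _  = _
not-intro {true}  ¬a = ¬a _

not-elim : ∀ {a} → T (not a) → ¬ T a
not-elim {false} _ ()

¬not⇒T : ∀ {a} → ¬ T (not a) → T a
¬not⇒T {true}  _  = _
¬not⇒T {false} ¬¬ = ¬¬ _

sound : ∀ {P : Set} (d : Dec P) → T ⌊ d ⌋ → P
sound d = toWitness

complete : ∀ {P : Set} {d : Dec P} → P → T ⌊ d ⌋
complete = fromWitness

any-intro : ∀ {k} (p : Fin k → Bool) (i : Fin k) → T (p i) → T (any p (allFin k))
any-intro p i pᵢ = any⁺ p (Any.tabulate⁺ i pᵢ)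

any-elim : ∀ {k} (p : Fin k → Bool) → T (any p (allFin k)) → ∃[ i ] T (p i)
any-elim {k} p h = Any.tabulate⁻ (any⁻ p (allFin k) h)

all-intro : ∀ {k} (p : Fin k → Bool) → (∀ i → T (p i)) → T (all p (allFin k))
all-intro p h = all⁻ p (All.tabulate⁺ h)

all-elim : ∀ {k} (p : Fin k → Bool) → T (all p (allFin k)) → ∀ i → T (p i)
all-elim {k} p h = All.tabulate⁻ (all⁺ p (allFin k) h)

all-counterexample : ∀ {k} (p : Fin k → Bool) → ¬ T (all p (allFin k)) → ∃[ i ] ¬ T (p i)
all-counterexample {k} p h =
  Any.tabulate⁻ (¬All⇒Any¬ (T? ∘ p) (allFin k) (h ∘ all⁻ p))

[_] : Bool → ℕ
[ true ]  = 1
[ false ] = 0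

[]≤1 : ∀ b → [ b ] ≤ 1
[]≤1 true  = ≤-refl
[]≤1 false = z≤n

[]≡1 : ∀ {b} → T b → [ b ] ≡ 1
[]≡1 {true} _ = refl

[]≡0 : ∀ {b} → ¬ T b → [ b ] ≡ 0
[]≡0 {false} _  = refl
[]≡0 {true}  ¬b = contradiction _ ¬b

[]-mono-∨ : ∀ a b → [ b ] ≤ [ a ∨ b ]
[]-mono-∨ true  b = []≤1 b
[]-mono-∨ false b = ≤-refl

length-filter≡∑ : ∀ {A : Set} {k} (p : A → Bool) (g : Fin k → A) →
  length (filter (λ a → p a Bool.≟ true) (tabulate g)) ≡ ∑[ i < k ] [ p (g i) ]
length-filter≡∑ {k = zero}  p g = refl
length-filter≡∑ {k = suc k} p g with p (g zero)
... | true  = cong suc (length-filter≡∑ p (g ∘ suc))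
... | false = length-filter≡∑ p (g ∘ suc)

∑-mono : ∀ {k} {f g : Fin k → ℕ} → (∀ i → f i ≤ g i) → sum f ≤ sum g
∑-mono {zero}  h = z≤n
∑-mono {suc k} h = +-mono-≤ (h zero) (∑-mono (h ∘ suc))

∑-mono-< : ∀ {k} {f g : Fin k → ℕ} → (∀ i → f i ≤ g i) → ∀ j → f j < g j → sum f < sum g
∑-mono-< h zero    lt = +-mono-<-≤ lt (∑-mono (h ∘ suc))
∑-mono-< h (suc j) lt = +-mono-≤-< (h zero) (∑-mono-< (h ∘ suc) j lt)

term≤∑ : ∀ {k} (f : Fin k → ℕ) i → f i ≤ sum f
term≤∑ f zero    = m≤m+n _ _
term≤∑ f (suc i) = ≤-trans (term≤∑ (f ∘ suc) i) (m≤n+m _ _)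

witness≤∑ : ∀ {k} (p : Fin k → Bool) i → T (p i) → 1 ≤ ∑[ i < k ] [ p i ]
witness≤∑ p i pᵢ = subst (_≤ _) ([]≡1 pᵢ) (term≤∑ (λ i → [ p i ]) i)

two-witnesses≤∑ : ∀ {k} (p : Fin k → Bool) i j → i ≢ j → T (p i) → T (p j) →
  2 ≤ ∑[ i < k ] [ p i ]
two-witnesses≤∑ p zero    zero    i≢j _  _  = contradiction refl i≢j
two-witnesses≤∑ p zero    (suc j) _   pᵢ pⱼ =
  +-mono-≤ (≤-reflexive (sym ([]≡1 pᵢ))) (witness≤∑ (p ∘ suc) j pⱼ)
two-witnesses≤∑ p (suc i) zero    _   pᵢ pⱼ =
  +-mono-≤ (≤-reflexive (sym ([]≡1 pⱼ))) (witness≤∑ (p ∘ suc) i pᵢ)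
two-witnesses≤∑ p (suc i) (suc j) i≢j pᵢ pⱼ =
  ≤-trans (two-witnesses≤∑ (p ∘ suc) i j (i≢j ∘ cong suc) pᵢ pⱼ) (m≤n+m _ _)

∑[]≡0-or-witness : ∀ {k} (p : Fin k → Bool) → ∑[ i < k ] [ p i ] ≡ 0 ⊎ ∃[ i ] T (p i)
∑[]≡0-or-witness {zero}  p = inj₁ refl
∑[]≡0-or-witness {suc k} p with p zero in eq
... | true  = inj₂ (zero , subst T (sym eq) _)
... | false = Sum.map id (λ (i , pᵢ) → suc i , pᵢ) (∑[]≡0-or-witness (p ∘ suc))

∑[]≤1 : ∀ {k} (p : Fin k → Bool) → (∀ i j → T (p i) → T (p j) → i ≡ j) →
  ∑[ i < k ] [ p i ] ≤ 1
∑[]≤1 {zero}  p uniq = z≤n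
∑[]≤1 {suc k} p uniq with p zero in eq
... | false = ∑[]≤1 (p ∘ suc) λ i j pᵢ pⱼ → suc-injective (uniq _ _ pᵢ pⱼ)
... | true with ∑[]≡0-or-witness (p ∘ suc)
...   | inj₁ rest≡0     = ≤-reflexive (cong suc rest≡0)
...   | inj₂ (i , pᵢ) = contradiction (uniq zero (suc i) (subst T (sym eq) _) pᵢ) λ ()

∑-delta : ∀ {k} (c : Fin k) → ∑[ v < k ] [ ⌊ c ≟ v ⌋ ] ≡ 1
∑-delta c = ≤-antisym
  (∑[]≤1 (λ v → ⌊ c ≟ v ⌋) λ i j c≡i c≡j → trans (sym (sound (c ≟ i) c≡i)) (sound (c ≟ j) c≡j))
  (witness≤∑ (λ v → ⌊ c ≟ v ⌋) c (complete refl))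

inhabited⇒1≤ : ∀ {k} → Fin k → 1 ≤ k
inhabited⇒1≤ zero    = s≤s z≤n
inhabited⇒1≤ (suc _) = s≤s z≤n

distinct⇒2≤ : ∀ {k} {i j : Fin k} → i ≢ j → 2 ≤ k
distinct⇒2≤ {i = zero}  {zero}  i≢j = contradiction refl i≢j
distinct⇒2≤ {i = zero}  {suc j} _   = s≤s (inhabited⇒1≤ j)
distinct⇒2≤ {i = suc i}         _   = s≤s (inhabited⇒1≤ i)

-- Walks, components and matchings in a fixed simple graph.

module _ (G : SimpleGraph) where
  open SimpleGraph G

  end₁ end₂ : Fin m → Fin n
  end₁ e = proj₁ (ends e)
  end₂ e = proj₂ (ends e)

  _∈E_ : Fin m → Subset m → Set
  e ∈E S = T (mem G e S)

  Incident : Fin n → Fin m → Set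
  Incident v e = T (incident G v e)

  Reaches : Subset m → ℕ → Fin n → Fin n → Set
  Reaches S j u v = T (reach G S j u v)

  IsMatching : Subset m → Set
  IsMatching B = T (isMatching G B)

  incident⁻ : ∀ v e → Incident v e → v ≡ end₁ e ⊎ v ≡ end₂ e
  incident⁻ v e h = Sum.map (sound (v ≟ end₁ e)) (sound (v ≟ end₂ e)) (∨-elim h)

  incident⁺ : ∀ {v} e → v ≡ end₁ e ⊎ v ≡ end₂ e → Incident v e
  incident⁺ {v} e (inj₁ refl) = ∨-introˡ {⌊ v ≟ end₁ e ⌋} (complete refl)
  incident⁺ {v} e (inj₂ refl) = ∨-introʳ {⌊ v ≟ end₁ e ⌋} (complete refl)

  incident-end₁ : ∀ e → Incident (end₁ e) e
  incident-end₁ e = incident⁺ e (inj₁ refl)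

  incident-end₂ : ∀ e → Incident (end₂ e) e
  incident-end₂ e = incident⁺ e (inj₂ refl)

  lowEnd : Fin m → Fin n
  lowEnd e = if ⌊ end₁ e <? end₂ e ⌋ then end₁ e else end₂ e

  lowEnd-incident : ∀ e → Incident (lowEnd e) e
  lowEnd-incident e with end₁ e <? end₂ e
  ... | yes _ = incident-end₁ e
  ... | no  _ = incident-end₂ e

  -- The other endpoint of an edge is larger (edges are not loops).
  lowEnd-< : ∀ {w} e → Incident w e → w ≢ lowEnd e → lowEnd e Fin.< w
  lowEnd-< {w} e iw w≢low with end₁ e <? end₂ e | incident⁻ w e iw
  ... | yes _   | inj₁ refl = contradiction refl w≢low
  ... | yes lt  | inj₂ refl = lt
  ... | no  _   | inj₂ refl = contradiction refl w≢low
  ... | no  ¬lt | inj₁ refl with <-cmp (end₁ e) (end₂ e)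
  ...   | tri< lt _ _ = contradiction lt ¬lt
  ...   | tri≈ _ eq _ = contradiction eq (loopless e)
  ...   | tri> _ _ gt = gt

  reach-refl : ∀ S j u → Reaches S j u u
  reach-refl S zero    u = complete refl
  reach-refl S (suc j) u = ∨-introˡ (reach-refl S j u)

  reach-mono : ∀ S {j j'} u v → j ≤′ j' → Reaches S j u v → Reaches S j' u v
  reach-mono S u v ≤′-refl        r = r
  reach-mono S u v (≤′-step j≤j') r = ∨-introˡ (reach-mono S u v j≤j' r)

  reach-step : ∀ S j u w v e → Reaches S j u w → e ∈E S →
    Incident w e → Incident v e → Reaches S (suc j) u v
  reach-step S j u w v e r e∈S iw iv with incident⁻ w e iw | incident⁻ v e iv
  ... | inj₁ refl | inj₁ refl = ∨-introˡ r
  ... | inj₂ refl | inj₂ refl = ∨-introˡ r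
  ... | inj₁ refl | inj₂ refl = ∨-introʳ {reach G S j u v}
    (any-intro _ e (∧-intro e∈S (∨-introˡ (∧-intro r (complete refl)))))
  ... | inj₂ refl | inj₁ refl = ∨-introʳ {reach G S j u v}
    (any-intro _ e (∧-intro e∈S
      (∨-introʳ {reach G S j u (end₁ e) ∧ ⌊ end₁ e ≟ end₂ e ⌋} (∧-intro r (complete refl)))))

  reach-last : ∀ S j u v → Reaches S (suc j) u v →
    Reaches S j u v ⊎ ∃[ e ] ∃[ w ] e ∈E S × Reaches S j u w × Incident w e × Incident v e
  reach-last S j u v r with ∨-elim {reach G S j u v} r
  ... | inj₁ r' = inj₁ r'
  ... | inj₂ h with any-elim _ h
  ...   | e , s with ∧-split (mem G e S) s
  ...     | e∈S , last with ∨-elim {reach G S j u (end₁ e) ∧ ⌊ v ≟ end₂ e ⌋} last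
  ...       | inj₁ q = let r' , v≡end₂ = ∧-split (reach G S j u (end₁ e)) q in
    inj₂ (e , end₁ e , e∈S , r' , incident-end₁ e , incident⁺ e (inj₂ (sound (v ≟ end₂ e) v≡end₂)))
  ...       | inj₂ q = let r' , v≡end₁ = ∧-split (reach G S j u (end₂ e)) q in
    inj₂ (e , end₂ e , e∈S , r' , incident-end₂ e , incident⁺ e (inj₁ (sound (v ≟ end₁ e) v≡end₁)))

  edge-connects : ∀ S u v e → e ∈E S → Incident u e → Incident v e → Reaches S n u v
  edge-connects S u v e e∈S iu iv =
    reach-mono S u v (≤⇒≤′ (inhabited⇒1≤ v)) (reach-step S 0 u u v e (reach-refl S 0 u) e∈S iu iv)

  path-connects : ∀ S u w v e e' → u ≢ v → e ∈E S → e' ∈E S →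
    Incident u e → Incident w e → Incident w e' → Incident v e' → Reaches S n u v
  path-connects S u w v e e' u≢v e∈S e'∈S iu iw iw' iv =
    reach-mono S u v (≤⇒≤′ (distinct⇒2≤ u≢v))
      (reach-step S 1 u w v e' (reach-step S 0 u u w e (reach-refl S 0 u) e∈S iu iw) e'∈S iw' iv)

  not-least : ∀ S w v → w Fin.< v → Reaches S n w v → ¬ T (leastInComponent G S v)
  not-least S w v w<v w~v least =
    not-elim least (any-intro _ w (∧-intro (complete w<v) w~v))

  conflict : Subset m → Fin m → Fin m → Bool
  conflict B e e' = mem G e B ∧ mem G e' B ∧ not ⌊ e ≟ e' ⌋ ∧ adjacentEdges G e e'

  conflict⁺ : ∀ B e e' u → e ∈E B → e' ∈E B → e ≢ e' →
    Incident u e → Incident u e' → T (conflict B e e')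
  conflict⁺ B e e' u e∈B e'∈B e≢e' iu iu' =
    ∧-intro e∈B (∧-intro e'∈B (∧-intro (not-intro (e≢e' ∘ sound (e ≟ e')))
      (any-intro _ u (∧-intro iu iu'))))

  conflict⁻ : ∀ B e e' → T (conflict B e e') →
    e ∈E B × e' ∈E B × e ≢ e' × ∃[ u ] Incident u e × Incident u e'
  conflict⁻ B e e' c =
    let e∈B , c₁      = ∧-split (mem G e B) c
        e'∈B , c₂     = ∧-split (mem G e' B) c₁
        distinct , adj = ∧-split (not ⌊ e ≟ e' ⌋) c₂
        u , iuu'       = any-elim (λ v → incident G v e ∧ incident G v e') adj
    in e∈B , e'∈B , not-elim distinct ∘ complete , u , ∧-split (incident G u e) iuu'

  matching-no-conflict : ∀ B → IsMatching B → ∀ e e' → ¬ T (conflict B e e')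
  matching-no-conflict B μ e e' =
    not-elim (all-elim (λ e' → not (conflict B e e'))
      (all-elim (λ e → all (λ e' → not (conflict B e e')) (allFin m)) μ e) e')

  non-matching-conflict : ∀ B → ¬ IsMatching B → ∃[ e ] ∃[ e' ] T (conflict B e e')
  non-matching-conflict B ¬μ =
    let e , ¬all = all-counterexample (λ e → all (λ e' → not (conflict B e e')) (allFin m)) ¬μ
        e' , ¬ok = all-counterexample (λ e' → not (conflict B e e')) ¬all
    in e , e' , ¬not⇒T ¬ok

  matching-unique : ∀ B e e' u → IsMatching B → e ∈E B → e' ∈E B →
    Incident u e → Incident u e' → e ≡ e'
  matching-unique B e e' u μ e∈B e'∈B iu iu' with e ≟ e'
  ... | yes e≡e' = e≡e'
  ... | no  e≢e' = contradiction (conflict⁺ B e e' u e∈B e'∈B e≢e' iu iu')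
                                 (matching-no-conflict B μ e e')

  matching-walk : ∀ B j u v → IsMatching B → Reaches B j u v →
    u ≡ v ⊎ ∃[ e ] e ∈E B × Incident u e × Incident v e
  matching-walk B zero    u v μ r = inj₁ (sound (u ≟ v) r)
  matching-walk B (suc j) u v μ r with reach-last B j u v r
  ... | inj₁ r' = matching-walk B j u v μ r'
  ... | inj₂ (e , w , e∈B , r' , iw , iv) with matching-walk B j u w μ r'
  ...   | inj₁ refl = inj₂ (e , e∈B , iw , iv)
  ...   | inj₂ (e' , e'∈B , iu , iw') with matching-unique B e' e w μ e'∈B e∈B iw' iw
  ...     | refl = inj₂ (e , e∈B , iu , iv)

  chargedTo : Subset m → Fin n → Fin m → Bool
  chargedTo B v e = mem G e B ∧ ⌊ lowEnd e ≟ v ⌋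

  charge : Subset m → Fin n → ℕ
  charge B v = ∑[ e < m ] [ chargedTo B v e ]

  root : Subset m → Fin n → ℕ
  root B v = [ covered G B v ∧ leastInComponent G B v ]

  -- k_cov(B) counts roots: the components of (V(B),B) are indexed by their least vertex.
  kcov≡∑root : ∀ B → kcov G B ≡ ∑[ v < n ] root B v
  kcov≡∑root B = length-filter≡∑ (λ v → covered G B v ∧ leastInComponent G B v) id

  -- Each edge is charged to exactly one vertex, so |B| is the total charge.
  card≡∑charge : ∀ B → card G B ≡ ∑[ v < n ] charge B v
  card≡∑charge B = begin
    card G B                                   ≡⟨ length-filter≡∑ (λ e → mem G e B) id ⟩
    ∑[ e < m ] [ mem G e B ]                   ≡⟨ sum-cong-≗ charged-once ⟩
    ∑[ e < m ] ∑[ v < n ] [ chargedTo B v e ]  ≡⟨ ∑-comm (λ e v → [ chargedTo B v e ]) ⟩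
    ∑[ v < n ] charge B v                      ∎
    where
    open ≡-Reasoning
    charged-once : ∀ e → [ mem G e B ] ≡ ∑[ v < n ] [ chargedTo B v e ]
    charged-once e with mem G e B
    ... | true  = sym (∑-delta (lowEnd e))
    ... | false = sym (sum-replicate-zero n)

  -- The least vertex v of a covered component is the low end of an edge of B at v:
  -- otherwise that edge joins v to a smaller vertex.
  root-is-charged : ∀ B v → T (covered G B v) → T (leastInComponent G B v) →
    ∃[ e ] T (chargedTo B v e)
  root-is-charged B v cov least =
    let e , e∈B×iv = any-elim (λ e → mem G e B ∧ incident G v e) cov
        e∈B , iv   = ∧-split (mem G e B) e∈B×iv
    in e , ∧-intro e∈B (complete (low≡v e e∈B iv))
    where
    low≡v : ∀ e → e ∈E B → Incident v e → lowEnd e ≡ v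
    low≡v e e∈B iv with lowEnd e ≟ v
    ... | yes low≡v = low≡v
    ... | no  low≢v = contradiction least
      (not-least B (lowEnd e) v (lowEnd-< e iv (low≢v ∘ sym))
        (edge-connects B (lowEnd e) v e e∈B (lowEnd-incident e) iv))

  root≤charge : ∀ B v → root B v ≤ charge B v
  root≤charge B v with covered G B v in cov | leastInComponent G B v in least
  ... | false | _     = z≤n
  ... | true  | false = z≤n
  ... | true  | true  =
    let e , ch = root-is-charged B v (subst T (sym cov) _) (subst T (sym least) _)
    in witness≤∑ (chargedTo B v) e ch

  charged⁻ : ∀ B v e → T (chargedTo B v e) → e ∈E B × lowEnd e ≡ v
  charged⁻ B v e ch =
    let e∈B , low≡v = ∧-split (mem G e B) ch
    in e∈B , sound (lowEnd e ≟ v) low≡v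

  incident-at-lowEnd : ∀ {v} e → lowEnd e ≡ v → Incident v e
  incident-at-lowEnd e refl = lowEnd-incident e

  charged-to-lowEnd : ∀ B e → e ∈E B → T (chargedTo B (lowEnd e) e)
  charged-to-lowEnd B e e∈B = ∧-intro e∈B (complete refl)

  -- In a matching, a charged vertex v is the least vertex of its component:
  -- every vertex joined to v lies on the unique edge at v, whose low end is v.
  matching-root : ∀ B v e → IsMatching B → T (chargedTo B v e) → root B v ≡ 1
  matching-root B v e μ ch = []≡1 (∧-intro covered-v (not-intro no-smaller))
    where
    e∈B : e ∈E B
    e∈B = proj₁ (charged⁻ B v e ch)

    low≡v : lowEnd e ≡ v
    low≡v = proj₂ (charged⁻ B v e ch)

    iv : Incident v e
    iv = incident-at-lowEnd e low≡v

    covered-v : T (covered G B v)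
    covered-v = any-intro (λ e → mem G e B ∧ incident G v e) e (∧-intro e∈B iv)

    smaller-joined-to : ∀ w → w Fin.< v → ¬ Reaches B n w v
    smaller-joined-to w w<v w~v with matching-walk B n w v μ w~v
    ... | inj₁ w≡v = <-irrefl w≡v w<v
    ... | inj₂ (e' , e'∈B , iw , iv') with matching-unique B e' e v μ e'∈B e∈B iv' iv
    ...   | refl = <-asym w<v (subst (Fin._< w) low≡v
                     (lowEnd-< e iw λ w≡low → <-irrefl (trans w≡low low≡v) w<v))

    no-smaller : ¬ T (any (λ w → ⌊ w <? v ⌋ ∧ connected G B w v) (allFin n))
    no-smaller h =
      let w , s       = any-elim (λ w → ⌊ w <? v ⌋ ∧ connected G B w v) h
          w<v , w~v   = ∧-split ⌊ w <? v ⌋ s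
      in smaller-joined-to w (sound (w <? v) w<v) w~v

  -- In a matching at most one edge meets v, so at most one is charged to v …
  matching-charge≤1 : ∀ B v → IsMatching B → charge B v ≤ 1
  matching-charge≤1 B v μ = ∑[]≤1 (chargedTo B v) λ e e' ch ch' →
    let e∈B , low≡v = charged⁻ B v e ch ; e'∈B , low'≡v = charged⁻ B v e' ch'
    in matching-unique B e e' v μ e∈B e'∈B
         (incident-at-lowEnd e low≡v) (incident-at-lowEnd e' low'≡v)

  charge≤root : ∀ B → IsMatching B → ∀ v → charge B v ≤ root B v
  charge≤root B μ v with ∑[]≡0-or-witness (chargedTo B v)
  ... | inj₁ uncharged = subst (_≤ root B v) (sym uncharged) z≤n
  ... | inj₂ (e , ch)  =
    subst (charge B v ≤_) (sym (matching-root B v e μ ch)) (matching-charge≤1 B v μ)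

  -- Two edges of B meeting at a vertex with different low ends: the larger low
  -- end is joined to the smaller one, so it is charged without being a root.
  larger-lowEnd-excess : ∀ B e e' u → e ∈E B → e' ∈E B → Incident u e → Incident u e' →
    lowEnd e Fin.< lowEnd e' → root B (lowEnd e') < charge B (lowEnd e')
  larger-lowEnd-excess B e e' u e∈B e'∈B iu iu' lt =
    subst (_< charge B v) (sym ([]≡0 (¬least ∘ proj₂ ∘ ∧-split (covered G B v))))
      (witness≤∑ (chargedTo B v) e' (charged-to-lowEnd B e' e'∈B))
    where
    v : Fin n
    v = lowEnd e'
    ¬least : ¬ T (leastInComponent G B v)
    ¬least = not-least B (lowEnd e) v lt
      (path-connects B (lowEnd e) u v e e' (<⇒≢ lt) e∈B e'∈B
        (lowEnd-incident e) iu iu' (lowEnd-incident e'))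

  -- Two distinct edges of B with the same low end v give charge B v ≥ 2 > root B v.
  shared-lowEnd-excess : ∀ B e e' → e ∈E B → e' ∈E B → e ≢ e' → lowEnd e ≡ lowEnd e' →
    root B (lowEnd e) < charge B (lowEnd e)
  shared-lowEnd-excess B e e' e∈B e'∈B e≢e' same = ≤-trans (s≤s ([]≤1 _))
    (two-witnesses≤∑ (chargedTo B (lowEnd e)) e e' e≢e' (charged-to-lowEnd B e e∈B) ch')
    where
    ch' : T (chargedTo B (lowEnd e) e')
    ch' = ∧-intro e'∈B (complete (sym same))

  non-matching-excess : ∀ B → ¬ IsMatching B → ∃[ v ] root B v < charge B v
  non-matching-excess B ¬μ with non-matching-conflict B ¬μ
  ... | e , e' , c with conflict⁻ B e e' c
  ...   | e∈B , e'∈B , e≢e' , u , iu , iu' with <-cmp (lowEnd e) (lowEnd e')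
  ...     | tri< lt _ _ = lowEnd e' , larger-lowEnd-excess B e e' u e∈B e'∈B iu iu' lt
  ...     | tri≈ _ eq _ = lowEnd e , shared-lowEnd-excess B e e' e∈B e'∈B e≢e' eq
  ...     | tri> _ _ gt = lowEnd e , larger-lowEnd-excess B e' e u e'∈B e∈B iu' iu gt

  kcov≤card : ∀ B → kcov G B ≤ card G B
  kcov≤card B =
    subst₂ _≤_ (sym (kcov≡∑root B)) (sym (card≡∑charge B)) (∑-mono (root≤charge B))

  matching⇒card≤kcov : ∀ B → IsMatching B → card G B ≤ kcov G B
  matching⇒card≤kcov B μ =
    subst₂ _≤_ (sym (card≡∑charge B)) (sym (kcov≡∑root B)) (∑-mono (charge≤root B μ))

  non-matching⇒kcov<card : ∀ B → ¬ IsMatching B → kcov G B < card G B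
  non-matching⇒kcov<card B ¬μ =
    let v , excess = non-matching-excess B ¬μ
    in subst₂ _<_ (sym (kcov≡∑root B)) (sym (card≡∑charge B))
         (∑-mono-< (root≤charge B) v excess)

  card-∪-< : ∀ A B e → e ∈E A → ¬ e ∈E B → card G B < card G (A ∪ B)
  card-∪-< A B e e∈A e∉B =
    subst₂ _<_ (sym (length-filter≡∑ (λ i → mem G i B) id))
               (sym (length-filter≡∑ (λ i → mem G i (A ∪ B)) id))
               (∑-mono-< grows e strict)
    where
    mem-∪ : ∀ i → mem G i (A ∪ B) ≡ mem G i A ∨ mem G i B
    mem-∪ i = lookup-zipWith _∨_ i A B

    grows : ∀ i → [ mem G i B ] ≤ [ mem G i (A ∪ B) ]
    grows i = subst (λ b → [ mem G i B ] ≤ [ b ]) (sym (mem-∪ i))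
                    ([]-mono-∨ (mem G i A) (mem G i B))

    strict : [ mem G e B ] < [ mem G e (A ∪ B) ]
    strict = subst₂ _<_ (sym ([]≡0 e∉B)) (sym ([]≡1 (subst T (sym (mem-∪ e)) (∨-introˡ e∈A))))
                        (s≤s z≤n)

  -- If V(A) ∩ V(B) = ∅, no edge of A lies in B (both would cover its first end).
  disjoint⇒∉ : ∀ A B e → T (vdisjoint G A B) → e ∈E A → ¬ e ∈E B
  disjoint⇒∉ A B e disjoint e∈A e∈B =
    not-elim (all-elim (λ v → not (covered G A v ∧ covered G B v)) disjoint (end₁ e))
      (∧-intro (covers A e∈A) (covers B e∈B))
    where
    covers : ∀ S → e ∈E S → T (covered G S (end₁ e))
    covers S e∈S =
      any-intro (λ f → mem G f S ∧ incident G (end₁ e) f) e (∧-intro e∈S (incident-end₁ e))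

  ∅-disjoint : ∀ B → T (vdisjoint G ⊥ B)
  ∅-disjoint B = all-intro (λ v → not (covered G ⊥ v ∧ covered G B v)) λ v →
    not-intro λ h →
      let e , s = any-elim (λ e → mem G e ⊥ ∧ incident G v e) (proj₁ (∧-split (covered G ⊥ v) h))
      in subst T (lookup-replicate e outside) (proj₁ (∧-split (mem G e ⊥) s))

  -- The exponent |A ∪ B| ∸ k_cov(B) of 0 in the summand of ξ_lab(G,1,0,1,t̄):
  -- positive when A has an edge (facts (i) and (ii)) …
  deficit-nonempty : ∀ A B e → T (vdisjoint G A B) → e ∈E A → card G (A ∪ B) ∸ kcov G B ≢ 0
  deficit-nonempty A B e disjoint e∈A no-deficit = n≮n (card G (A ∪ B))
    (≤-<-trans (≤-trans (m∸n≡0⇒m≤n no-deficit) (kcov≤card B))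
               (card-∪-< A B e e∈A (disjoint⇒∉ A B e disjoint e∈A)))

  deficit-matching : ∀ B → IsMatching B → card G B ∸ kcov G B ≡ 0
  deficit-matching B μ = m≤n⇒m∸n≡0 (matching⇒card≤kcov B μ)

  deficit-non-matching : ∀ B → ¬ IsMatching B → card G B ∸ kcov G B ≢ 0
  deficit-non-matching B ¬μ no-deficit =
    n≮n (kcov G B) (<-≤-trans (non-matching⇒kcov<card B ¬μ) (m∸n≡0⇒m≤n no-deficit))

module _ {c ℓ : Level} (R : CommutativeRing c ℓ) (G : SimpleGraph) where
  open CommutativeRing R hiding (zero) renaming (refl to ≈-refl; sym to ≈-sym; trans to ≈-trans)
  open SimpleGraph G
  open SetoidReasoning setoid

  Σ-cong : ∀ {A : Set} (xs : List A) {f g : A → Carrier} →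
    (∀ a → f a ≈ g a) → Σ-list G R xs f ≈ Σ-list G R xs g
  Σ-cong []       f≈g = ≈-refl
  Σ-cong (a ∷ xs) f≈g = +-cong (f≈g a) (Σ-cong xs f≈g)

  Σ-vanishes : ∀ {A : Set} (xs : List A) {f : A → Carrier} →
    (∀ a → f a ≈ 0#) → Σ-list G R xs f ≈ 0#
  Σ-vanishes []       f≈0 = ≈-refl
  Σ-vanishes (a ∷ xs) f≈0 = ≈-trans (+-cong (f≈0 a) (Σ-vanishes xs f≈0)) (+-identityˡ 0#)

  Σ-++ : ∀ {A : Set} (xs ys : List A) (f : A → Carrier) →
    Σ-list G R (xs ++ ys) f ≈ Σ-list G R xs f + Σ-list G R ys f
  Σ-++ []       ys f = ≈-sym (+-identityˡ _)
  Σ-++ (a ∷ xs) ys f = ≈-trans (+-congˡ (Σ-++ xs ys f)) (≈-sym (+-assoc _ _ _))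

  Σ-map : ∀ {A B : Set} (xs : List A) (h : A → B) (f : B → Carrier) →
    Σ-list G R (map h xs) f ≡ Σ-list G R xs (f ∘ h)
  Σ-map []       h f = refl
  Σ-map (a ∷ xs) h f = cong (f (h a) +_) (Σ-map xs h f)

  Σ-subsets-at-∅ : ∀ k (g : Subset k → Carrier) →
    (∀ S i → T (lookup S i) → g S ≈ 0#) → Σ-list G R (subsets k) g ≈ g ⊥
  Σ-subsets-at-∅ zero    g g-vanishes = +-identityʳ _
  Σ-subsets-at-∅ (suc k) g g-vanishes = begin
    Σ-list G R (map (outside ∷_) (subsets k) ++ map (inside ∷_) (subsets k)) g
      ≈⟨ Σ-++ (map (outside ∷_) (subsets k)) (map (inside ∷_) (subsets k)) g ⟩
    Σ-list G R (map (outside ∷_) (subsets k)) g + Σ-list G R (map (inside ∷_) (subsets k)) g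
      ≡⟨ cong₂ _+_ (Σ-map (subsets k) (outside ∷_) g) (Σ-map (subsets k) (inside ∷_) g) ⟩
    Σ-list G R (subsets k) (g ∘ (outside ∷_)) + Σ-list G R (subsets k) (g ∘ (inside ∷_))
      ≈⟨ +-cong (Σ-subsets-at-∅ k (g ∘ (outside ∷_)) (λ S i → g-vanishes (outside ∷ S) (suc i)))
                (Σ-vanishes (subsets k) (λ S → g-vanishes (inside ∷ S) zero _)) ⟩
    g ⊥ + 0#
      ≈⟨ +-identityʳ _ ⟩
    g ⊥ ∎

  pow-1 : ∀ d → pow G R 1# d ≈ 1#
  pow-1 zero    = ≈-refl
  pow-1 (suc d) = ≈-trans (*-identityˡ _) (pow-1 d)

  pow-0 : ∀ d → d ≢ 0 → pow G R 0# d ≈ 0#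
  pow-0 zero    d≢0 = contradiction refl d≢0
  pow-0 (suc d) _   = zeroˡ _

  weight : ℕ → ℕ → ℕ → Carrier → Carrier
  weight a b c p = pow G R 1# a * pow G R 0# b * pow G R 1# c * p

  weight-0 : ∀ a b c p → b ≢ 0 → weight a b c p ≈ 0#
  weight-0 a b c p b≢0 = begin
    pow G R 1# a * pow G R 0# b * pow G R 1# c * p ≈⟨ *-congʳ (*-congʳ (*-congˡ (pow-0 b b≢0))) ⟩
    pow G R 1# a * 0# * pow G R 1# c * p           ≈⟨ *-congʳ (*-congʳ (zeroʳ _)) ⟩
    0# * pow G R 1# c * p                          ≈⟨ *-congʳ (zeroˡ _) ⟩
    0# * p                                         ≈⟨ zeroˡ p ⟩
    0#                                             ∎

  weight-1 : ∀ a b c p → b ≡ 0 → weight a b c p ≈ p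
  weight-1 a _ c p refl = begin
    pow G R 1# a * 1# * pow G R 1# c * p ≈⟨ *-congʳ (*-cong (*-identityʳ _) (pow-1 c)) ⟩
    pow G R 1# a * 1# * p                ≈⟨ *-congʳ (≈-trans (*-identityʳ _) (pow-1 a)) ⟩
    1# * p                               ≈⟨ *-identityˡ p ⟩
    p                                    ∎

  module _ (t : Fin m → Carrier) where

    ξ-term : Subset m → Subset m → Carrier
    ξ-term A B = if vdisjoint G A B
      then weight (kcomp G (A ∪ B) ∸ kcov G B) (card G (A ∪ B) ∸ kcov G B) (kcov G B)
                  (prodOver G R (A ∪ B) t)
      else 0#

    M-term : Subset m → Carrier
    M-term M = if isMatching G M then prodOver G R M t else 0#

    ξ-term-nonempty : ∀ A B e → T (mem G e A) → ξ-term A B ≈ 0#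
    ξ-term-nonempty A B e e∈A with vdisjoint G A B in disjoint
    ... | false = ≈-refl
    ... | true  = weight-0 (kcomp G (A ∪ B) ∸ kcov G B) _ (kcov G B) (prodOver G R (A ∪ B) t)
      (deficit-nonempty G A B e (subst T (sym disjoint) _) e∈A)

    ξ-term-∅ : ∀ B → ξ-term ⊥ B ≈ M-term B
    -- The case `vdisjoint G ⊥ B = false` is absurd by ∅-disjoint.
    ξ-term-∅ B rewrite ∪-identityˡ B with vdisjoint G ⊥ B | ∅-disjoint G B
    ... | true | _ with isMatching G B in matching
    ...   | true  = weight-1 (kcomp G B ∸ kcov G B) _ (kcov G B) (prodOver G R B t)
                      (deficit-matching G B (subst T (sym matching) _))
    ...   | false = weight-0 (kcomp G B ∸ kcov G B) _ (kcov G B) (prodOver G R B t)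
                      (deficit-non-matching G B (subst T matching))

    ξ-at-∅ : ξlab G R 1# 0# 1# t ≈ Σ-list G R (subsets m) (ξ-term ⊥)
    ξ-at-∅ = Σ-subsets-at-∅ m (λ A → Σ-list G R (subsets m) (ξ-term A))
      λ A e e∈A → Σ-vanishes (subsets m) (λ B → ξ-term-nonempty A B e e∈A)

proposition6 : {c ℓ : Level} (R : CommutativeRing c ℓ) (G : SimpleGraph)
    (x : Fin (SimpleGraph.n G) → CommutativeRing.Carrier R)
    (y : Fin (SimpleGraph.m G) → CommutativeRing.Carrier R) →
    let open CommutativeRing R
        open SimpleGraph G
    in Mcol G R x y ≈ ξlab G R 1# 0# 1# (λ e → y e * x (proj₁ (ends e)) * x (proj₂ (ends e)))
proposition6 R G x y = begin
  Mcol G R x y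
    ≈⟨ Σ-cong R G (subsets m) (λ B → ≈-sym (ξ-term-∅ R G t B)) ⟩
  Σ-list G R (subsets m) (ξ-term R G t ⊥)
    ≈⟨ ≈-sym (ξ-at-∅ R G t) ⟩
  ξlab G R 1# 0# 1# t
    ∎
  where
  open CommutativeRing R using (Carrier; _*_; 0#; 1#; setoid) renaming (sym to ≈-sym)
  open SimpleGraph G using (m; ends)
  open SetoidReasoning setoid

  t : Fin m → Carrier
  t e = y e * x (proj₁ (ends e)) * x (proj₂ (ends e))
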